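{- Let $G$ be a finite abstract simplicial complex, $A'$ the adjacency matrix of its connection graph $G'$, and $g=(1+A')^{ -1}$. Then for every face $x \in G$, $$ \sum_{y \in G} g(x,y) = (-1)^{\dim(x)} g(x,x). $$
   Context: A finite abstract simplicial complex $G$ is a finite collection of non-empty finite sets (faces) closed under taking non-empty subsets; $\dim(x)=|x|-1$. The connection graph $G'$ has vertex set $G$, two distinct faces adjacent iff they have non-empty intersection; $A'$ is its adjacency matrix and $1$ the identity matrix. The matrix $1+A'$ is known to be invertible. -}

module Defs where

open import Data.Nat using (ℕ; zero; suc; _∸_)
open import Data.Fin using (Fin; zero; suc; _≟_)
open import Data.Fin.Subset using (Subset; Nonempty; _⊆_; _∩_; ∣_∣)
open import Data.Fin.Subset.Properties using (nonempty?)
open import Data.Rational using (ℚ; 0ℚ; 1ℚ; _+_; _*_; -_)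
open import Data.Product using (Σ; ∃; _×_)
open import Relation.Nullary using (yes; no)
open import Relation.Binary.PropositionalEquality using (_≡_)
open import Function.Definitions using (Injective)

record SimplicialComplex (n m : ℕ) : Set where
  field
    face          : Fin m → Subset n
    face-injective : Injective _≡_ _≡_ face
    face-nonempty : ∀ i → Nonempty (face i)
    face-closed   : ∀ i (s : Subset n) → Nonempty s → s ⊆ face i →
                    ∃ λ j → face j ≡ s
open SimplicialComplex public

dim : ∀ {n m} → SimplicialComplex n m → Fin m → ℕ
dim G i = ∣ face G i ∣ ∸ 1

signℚ : ℕ → ℚ
signℚ zero    = 1ℚ
signℚ (suc k) = - signℚ k

sumFin : ∀ {m} → (Fin m → ℚ) → ℚ
sumFin {zero}  f = 0ℚ
sumFin {suc m} f = f zero + sumFin (λ i → f (suc i))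

Matrix : ℕ → Set
Matrix m = Fin m → Fin m → ℚ

_⊗_ : ∀ {m} → Matrix m → Matrix m → Matrix m
(P ⊗ Q) i j = sumFin (λ k → P i k * Q k j)

identity : ∀ {m} → Matrix m
identity i j with i ≟ j
... | yes _ = 1ℚ
... | no  _ = 0ℚ

-- Adjacency matrix A' of the connection graph G':
-- distinct faces adjacent iff they intersect.
adjacency : ∀ {n m} → SimplicialComplex n m → Matrix m
adjacency G i j with i ≟ j
... | yes _ = 0ℚ
... | no  _ with nonempty? (face G i ∩ face G j)
...   | yes _ = 1ℚ
...   | no  _ = 0ℚ

onePlusA : ∀ {n m} → SimplicialComplex n m → Matrix m
onePlusA G i j = identity i j + adjacency G i j

IsInverse : ∀ {m} → Matrix m → Matrix m → Set
IsInverse M g = (∀ i j → (M ⊗ g) i j ≡ identity i j) × (∀ i j → (g ⊗ M) i j ≡ identity i j)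

module Submission where

-- Let ζ be the zeta matrix of the face poset (ζ x y = 1 iff x ⊆ y) and ω x = (-1)^dim(x). The faces
-- contained in both x and y are the faces of the simplex x ∩ y, whose Euler characteristic Σ ω is 1
-- (or there are none), so 1 + A' = ζᵀ Ω ζ with Ω = diag ω. Möbius inversion on the face poset,
-- proved by toggling a vertex, gives ζ⁻¹ = μ with μ x y = ω x ω y ζ x y; hence g = μ Ω μᵀ. The
-- columns of μ sum to ω, so row x of g sums to Σ_k μ x k, and as ζ² = ζ and ω² = 1 entrywise this is
-- ω x · g x x.

open import Algebra.Bundles using (CommutativeRing)
open import Data.Bool.Base using (true; false; not; if_then_else_)
open import Data.Empty using (⊥-elim)
open import Data.Fin.Base using (Fin; zero; suc)
open import Data.Fin.Permutation using (permutation)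
open import Data.Fin.Properties using (_≟_; suc-injective; any?)
open import Data.Fin.Subset
  using (Subset; Nonempty; _∈_; _∉_; _⊆_; _⊂_; _∩_; ⊥; ⁅_⁆; ∣_∣)
open import Data.Fin.Subset.Properties
  using (_∈?_; _⊆?_; nonempty?; ⊆-antisym; ⊆-trans; Empty-unique; ∉⊥; x∈⁅x⁆; x∈⁅y⁆⇒x≡y;
         ∣⁅x⁆∣≡1; p∩q⊆p; x∈p∩q⁺; x∈p∩q⁻)
open import Data.Maybe.Base using (nothing)
open import Data.Nat.Base using (ℕ; zero; suc; _∸_)
open import Data.Product.Base using (∃; _×_; _,_; proj₁; proj₂)
open import Data.Rational.Base using (ℚ; 0ℚ; 1ℚ; ½; _+_; _*_; -_)
open import Data.Rational.Properties
  using (+-*-ring; +-*-commutativeRing; +-identityˡ; +-identityʳ; +-inverseʳ;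
         *-identityˡ; *-identityʳ; *-zeroˡ; *-zeroʳ; *-comm; *-assoc;
         *-distribˡ-+; *-distribʳ-+; neg-distrib-+)
open import Data.Sum.Base using (_⊎_; inj₁; inj₂)
open import Data.Vec.Base using (_∷_; here; there)
open import Level using (0ℓ)
open import Relation.Binary.Bundles using (Setoid)
open import Relation.Binary.PropositionalEquality
open import Relation.Nullary using (Dec; yes; no; does; ¬_; ¬?)
open import Relation.Nullary.Decidable using (_×-dec_)
open import Relation.Unary using (Pred; Decidable)
open import Tactic.RingSolver using (solve-∀)
open import Tactic.RingSolver.Core.AlmostCommutativeRing
  using (AlmostCommutativeRing; fromCommutativeRing)

open import Algebra.Properties.Ring +-*-ring using (-‿involutive)
open import Algebra.Properties.Semiring.Sum (CommutativeRing.semiring +-*-commutativeRing)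
  using (sum; sum-cong-≗; ∑-distrib-+; ∑-comm; *-distribˡ-sum; sum-replicate-zero; sum-permute)

open import Defs

open ≡-Reasoning

ℚ-ring : AlmostCommutativeRing 0ℓ 0ℓ
ℚ-ring = fromCommutativeRing +-*-commutativeRing (λ _ → nothing)

x≡-x⇒x≡0 : ∀ x → x ≡ - x → x ≡ 0ℚ
x≡-x⇒x≡0 x x≡-x = begin
  x                ≡⟨ sym (*-identityˡ x) ⟩
  (½ + ½) * x      ≡⟨ *-distribʳ-+ x ½ ½ ⟩
  ½ * x + ½ * x    ≡⟨ sym (*-distribˡ-+ ½ x x) ⟩
  ½ * (x + x)      ≡⟨ cong (λ y → ½ * (x + y)) x≡-x ⟩
  ½ * (x + - x)    ≡⟨ cong (½ *_) (+-inverseʳ x) ⟩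
  ½ * 0ℚ           ≡⟨ *-zeroʳ ½ ⟩
  0ℚ               ∎

neg-*-neg : ∀ p q → - p * - q ≡ p * q
neg-*-neg = solve-∀ ℚ-ring

signℚ-squared : ∀ k → signℚ k * signℚ k ≡ 1ℚ
signℚ-squared zero    = refl
signℚ-squared (suc k) = trans (neg-*-neg (signℚ k) (signℚ k)) (signℚ-squared k)

-- Finite sums

sumFin≡sum : ∀ {m} (f : Fin m → ℚ) → sumFin f ≡ sum f
sumFin≡sum {zero}  f = refl
sumFin≡sum {suc m} f = cong (f zero +_) (sumFin≡sum (λ i → f (suc i)))

sumFin-cong : ∀ {m} {f g : Fin m → ℚ} → (∀ i → f i ≡ g i) → sumFin f ≡ sumFin g
sumFin-cong {f = f} {g} f≗g = begin
  sumFin f ≡⟨ sumFin≡sum f ⟩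
  sum f    ≡⟨ sum-cong-≗ f≗g ⟩
  sum g    ≡⟨ sumFin≡sum g ⟨
  sumFin g ∎

sumFin-zero : ∀ m → sumFin {m} (λ _ → 0ℚ) ≡ 0ℚ
sumFin-zero m = trans (sumFin≡sum {m} _) (sum-replicate-zero m)

sumFin-+ : ∀ {m} (f g : Fin m → ℚ) → sumFin (λ i → f i + g i) ≡ sumFin f + sumFin g
sumFin-+ f g = begin
  sumFin (λ i → f i + g i) ≡⟨ sumFin≡sum (λ i → f i + g i) ⟩
  sum (λ i → f i + g i)    ≡⟨ ∑-distrib-+ f g ⟩
  sum f + sum g            ≡⟨ cong₂ _+_ (sumFin≡sum f) (sumFin≡sum g) ⟨
  sumFin f + sumFin g      ∎

sumFin-*ˡ : ∀ {m} c (f : Fin m → ℚ) → sumFin (λ i → c * f i) ≡ c * sumFin f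
sumFin-*ˡ c f = begin
  sumFin (λ i → c * f i) ≡⟨ sumFin≡sum (λ i → c * f i) ⟩
  sum (λ i → c * f i)    ≡⟨ *-distribˡ-sum c f ⟨
  c * sum f              ≡⟨ cong (c *_) (sumFin≡sum f) ⟨
  c * sumFin f           ∎

sumFin-*ʳ : ∀ {m} c (f : Fin m → ℚ) → sumFin (λ i → f i * c) ≡ sumFin f * c
sumFin-*ʳ c f = begin
  sumFin (λ i → f i * c) ≡⟨ sumFin-cong (λ i → *-comm (f i) c) ⟩
  sumFin (λ i → c * f i) ≡⟨ sumFin-*ˡ c f ⟩
  c * sumFin f           ≡⟨ *-comm c (sumFin f) ⟩
  sumFin f * c           ∎

sumFin-neg : ∀ {m} (f : Fin m → ℚ) → sumFin (λ i → - f i) ≡ - sumFin f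
sumFin-neg {zero}  f = refl
sumFin-neg {suc m} f = trans (cong (- f zero +_) (sumFin-neg (λ i → f (suc i))))
                             (sym (neg-distrib-+ (f zero) (sumFin (λ i → f (suc i)))))

sumFin-comm : ∀ {m k} (f : Fin m → Fin k → ℚ) →
  sumFin (λ i → sumFin (f i)) ≡ sumFin (λ j → sumFin (λ i → f i j))
sumFin-comm f = begin
  sumFin (λ i → sumFin (f i))            ≡⟨ sumFin-cong (λ i → sumFin≡sum (f i)) ⟩
  sumFin (λ i → sum (f i))               ≡⟨ sumFin≡sum (λ i → sum (f i)) ⟩
  sum (λ i → sum (f i))                  ≡⟨ ∑-comm f ⟩
  sum (λ j → sum (λ i → f i j))          ≡⟨ sumFin≡sum (λ j → sum (λ i → f i j)) ⟨
  sumFin (λ j → sum (λ i → f i j))       ≡⟨ sumFin-cong (λ j → sumFin≡sum (λ i → f i j)) ⟨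
  sumFin (λ j → sumFin (λ i → f i j))    ∎

sumFin-sign-reversing-involution : ∀ {m} (σ : Fin m → Fin m) → (∀ i → σ (σ i) ≡ i) →
  (f : Fin m → ℚ) → (∀ i → f (σ i) ≡ - f i) → sumFin f ≡ 0ℚ
sumFin-sign-reversing-involution σ σ-involutive f f∘σ≡-f = x≡-x⇒x≡0 (sumFin f) (begin
  sumFin f                ≡⟨ sumFin≡sum f ⟩
  sum f                   ≡⟨ sum-permute f (permutation σ σ σ-involutive σ-involutive) ⟩
  sum (λ i → f (σ i))     ≡⟨ sumFin≡sum (λ i → f (σ i)) ⟨
  sumFin (λ i → f (σ i))  ≡⟨ sumFin-cong f∘σ≡-f ⟩
  sumFin (λ i → - f i)    ≡⟨ sumFin-neg f ⟩
  - sumFin f              ∎)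

𝟙 : ∀ {p} {P : Set p} → Dec P → ℚ
𝟙 d = if does d then 1ℚ else 0ℚ

𝟙-yes : ∀ {p} {P : Set p} (d : Dec P) → P → 𝟙 d ≡ 1ℚ
𝟙-yes (yes _)  _ = refl
𝟙-yes (no ¬x) x = ⊥-elim (¬x x)

𝟙-no : ∀ {p} {P : Set p} (d : Dec P) → ¬ P → 𝟙 d ≡ 0ℚ
𝟙-no (yes x) ¬x = ⊥-elim (¬x x)
𝟙-no (no _)  _  = refl

module _ {p q} {P : Set p} {Q : Set q} where

  𝟙-× : (a : Dec P) (b : Dec Q) → 𝟙 a * 𝟙 b ≡ 𝟙 (a ×-dec b)
  𝟙-× (yes _) (yes _) = refl
  𝟙-× (yes _) (no _)  = refl
  𝟙-× (no _)  b       = *-zeroˡ (𝟙 b)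

  𝟙-⇔ : (P → Q) → (Q → P) → (a : Dec P) (b : Dec Q) → 𝟙 a ≡ 𝟙 b
  𝟙-⇔ to from (yes x) b = sym (𝟙-yes b (to x))
  𝟙-⇔ to from (no ¬x) b = sym (𝟙-no b (λ y → ¬x (from y)))

sumFin-𝟙-none : ∀ {m p} {P : Fin m → Set p} (P? : ∀ k → Dec (P k)) (f : Fin m → ℚ) →
  (∀ k → ¬ P k) → sumFin (λ k → 𝟙 (P? k) * f k) ≡ 0ℚ
sumFin-𝟙-none {m} P? f none = begin
  sumFin (λ k → 𝟙 (P? k) * f k) ≡⟨ sumFin-cong (λ k → cong (_* f k) (𝟙-no (P? k) (none k))) ⟩
  sumFin (λ k → 0ℚ * f k)       ≡⟨ sumFin-cong (λ k → *-zeroˡ (f k)) ⟩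
  sumFin {m} (λ _ → 0ℚ)         ≡⟨ sumFin-zero m ⟩
  0ℚ                            ∎

identity≡𝟙 : ∀ {m} (i j : Fin m) → identity i j ≡ 𝟙 (i ≟ j)
identity≡𝟙 i j with i ≟ j
... | yes _ = refl
... | no _  = refl

identity-refl : ∀ {m} (i : Fin m) → identity i i ≡ 1ℚ
identity-refl i = trans (identity≡𝟙 i i) (𝟙-yes (i ≟ i) refl)

identity-≢ : ∀ {m} {i j : Fin m} → ¬ i ≡ j → identity i j ≡ 0ℚ
identity-≢ {i = i} {j} i≢j = trans (identity≡𝟙 i j) (𝟙-no (i ≟ j) i≢j)

identity-sym : ∀ {m} (i j : Fin m) → identity i j ≡ identity j i
identity-sym i j = begin
  identity i j  ≡⟨ identity≡𝟙 i j ⟩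
  𝟙 (i ≟ j)     ≡⟨ 𝟙-⇔ sym sym (i ≟ j) (j ≟ i) ⟩
  𝟙 (j ≟ i)     ≡⟨ identity≡𝟙 j i ⟨
  identity j i  ∎

identity-suc : ∀ {m} (i j : Fin m) → identity (suc i) (suc j) ≡ identity i j
identity-suc i j = begin
  identity (suc i) (suc j)  ≡⟨ identity≡𝟙 (suc i) (suc j) ⟩
  𝟙 (suc i ≟ suc j)         ≡⟨ 𝟙-⇔ suc-injective (cong suc) (suc i ≟ suc j) (i ≟ j) ⟩
  𝟙 (i ≟ j)                 ≡⟨ identity≡𝟙 i j ⟨
  identity i j              ∎

sumFin-identityˡ : ∀ {m} (i : Fin m) (f : Fin m → ℚ) → sumFin (λ j → identity i j * f j) ≡ f i
sumFin-identityˡ {suc m} zero f = begin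
  1ℚ * f zero + sumFin (λ j → 0ℚ * f (suc j)) ≡⟨ cong₂ _+_ (*-identityˡ (f zero))
                                                   (sumFin-cong (λ j → *-zeroˡ (f (suc j)))) ⟩
  f zero + sumFin {m} (λ _ → 0ℚ)               ≡⟨ cong (f zero +_) (sumFin-zero m) ⟩
  f zero + 0ℚ                                  ≡⟨ +-identityʳ (f zero) ⟩
  f zero                                       ∎
sumFin-identityˡ {suc m} (suc i) f = begin
  0ℚ * f zero + sumFin (λ j → identity (suc i) (suc j) * f (suc j))
    ≡⟨ cong₂ _+_ (*-zeroˡ (f zero))
                 (sumFin-cong (λ j → cong (_* f (suc j)) (identity-suc i j))) ⟩
  0ℚ + sumFin (λ j → identity i j * f (suc j))
    ≡⟨ +-identityˡ _ ⟩
  sumFin (λ j → identity i j * f (suc j))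
    ≡⟨ sumFin-identityˡ i (λ j → f (suc j)) ⟩
  f (suc i) ∎

sumFin-identityʳ : ∀ {m} (i : Fin m) (f : Fin m → ℚ) → sumFin (λ j → f j * identity j i) ≡ f i
sumFin-identityʳ i f = trans (sumFin-cong λ j → trans (*-comm (f j) (identity j i))
                                                       (cong (_* f j) (identity-sym j i)))
                             (sumFin-identityˡ i f)

identity-*-reindex : ∀ {m} (d : Fin m → ℚ) (i j : Fin m) → identity i j * d i ≡ identity i j * d j
identity-*-reindex d i j with i ≟ j
... | yes refl = refl
... | no _     = trans (*-zeroˡ (d i)) (sym (*-zeroˡ (d j)))

identity-conj : ∀ {m} (d : Fin m → ℚ) → (∀ i → d i * d i ≡ 1ℚ) →
  ∀ i j → d i * identity i j * d j ≡ identity i j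
identity-conj d d²≡1 i j with i ≟ j
... | yes refl = trans (cong (_* d i) (*-identityʳ (d i))) (d²≡1 i)
... | no _     = trans (cong (_* d j) (*-zeroʳ (d i))) (*-zeroˡ (d j))

-- Matrix algebra

module _ {m : ℕ} where

  infix 4 _≈ₘ_
  _≈ₘ_ : Matrix m → Matrix m → Set
  P ≈ₘ Q = ∀ i j → P i j ≡ Q i j

  ≈ₘ-setoid : Setoid 0ℓ 0ℓ
  ≈ₘ-setoid = record
    { Carrier       = Matrix m
    ; _≈_           = _≈ₘ_
    ; isEquivalence = record
      { refl  = λ i j → refl
      ; sym   = λ P≈Q i j → sym (P≈Q i j)
      ; trans = λ P≈Q Q≈R i j → trans (P≈Q i j) (Q≈R i j)
      }
    }

  open Setoid ≈ₘ-setoid public using () renaming (refl to ≈ₘ-refl; trans to ≈ₘ-trans)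
  open import Relation.Binary.Reasoning.Setoid ≈ₘ-setoid
    using (step-≈-⟩; step-≈-⟨) renaming (begin_ to beginₘ_; _∎ to _∎ₘ)

  infix 30 _ᵀ
  _ᵀ : Matrix m → Matrix m
  (P ᵀ) i j = P j i

  infixr 8 _⊙_
  _⊙_ : (Fin m → ℚ) → Matrix m → Matrix m
  (d ⊙ P) i j = d i * P i j

  ⊗-cong : ∀ {P P′ Q Q′} → P ≈ₘ P′ → Q ≈ₘ Q′ → (P ⊗ Q) ≈ₘ (P′ ⊗ Q′)
  ⊗-cong P≈P′ Q≈Q′ i j = sumFin-cong (λ k → cong₂ _*_ (P≈P′ i k) (Q≈Q′ k j))

  ⊗-assoc : ∀ P Q R → ((P ⊗ Q) ⊗ R) ≈ₘ (P ⊗ (Q ⊗ R))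
  ⊗-assoc P Q R i j = begin
    sumFin (λ k → sumFin (λ l → P i l * Q l k) * R k j)
      ≡⟨ sumFin-cong (λ k → sumFin-*ʳ (R k j) (λ l → P i l * Q l k)) ⟨
    sumFin (λ k → sumFin (λ l → P i l * Q l k * R k j))
      ≡⟨ sumFin-comm (λ k l → P i l * Q l k * R k j) ⟩
    sumFin (λ l → sumFin (λ k → P i l * Q l k * R k j))
      ≡⟨ sumFin-cong (λ l → sumFin-cong (λ k → *-assoc (P i l) (Q l k) (R k j))) ⟩
    sumFin (λ l → sumFin (λ k → P i l * (Q l k * R k j)))
      ≡⟨ sumFin-cong (λ l → sumFin-*ˡ (P i l) (λ k → Q l k * R k j)) ⟩
    sumFin (λ l → P i l * sumFin (λ k → Q l k * R k j)) ∎

  identity-⊗ : ∀ P → (identity ⊗ P) ≈ₘ P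
  identity-⊗ P i j = sumFin-identityˡ i (λ k → P k j)

  ⊗-identity : ∀ P → (P ⊗ identity) ≈ₘ P
  ⊗-identity P i j = sumFin-identityʳ j (P i)

  identityᵀ : identity ᵀ ≈ₘ identity
  identityᵀ i j = identity-sym j i

  ᵀ-⊗ : ∀ P Q → (P ⊗ Q) ᵀ ≈ₘ (Q ᵀ ⊗ P ᵀ)
  ᵀ-⊗ P Q i j = sumFin-cong (λ k → *-comm (P j k) (Q k i))

  ⊙-cong : ∀ d {P Q} → P ≈ₘ Q → (d ⊙ P) ≈ₘ (d ⊙ Q)
  ⊙-cong d P≈Q i j = cong (d i *_) (P≈Q i j)

  ⊙-⊗ : ∀ d P Q → ((d ⊙ P) ⊗ Q) ≈ₘ (d ⊙ (P ⊗ Q))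
  ⊙-⊗ d P Q i j = trans (sumFin-cong (λ k → *-assoc (d i) (P i k) (Q k j)))
                        (sumFin-*ˡ (d i) (λ k → P i k * Q k j))

  ⊙-involutive : ∀ d → (∀ i → d i * d i ≡ 1ℚ) → ∀ P → (d ⊙ d ⊙ P) ≈ₘ P
  ⊙-involutive d d²≡1 P i j = begin
    d i * (d i * P i j)  ≡⟨ *-assoc (d i) (d i) (P i j) ⟨
    d i * d i * P i j    ≡⟨ cong (_* P i j) (d²≡1 i) ⟩
    1ℚ * P i j           ≡⟨ *-identityˡ (P i j) ⟩
    P i j                ∎

  left-inverse≈right-inverse : ∀ {M g h} → (g ⊗ M) ≈ₘ identity → (M ⊗ h) ≈ₘ identity → g ≈ₘ h
  left-inverse≈right-inverse {M} {g} {h} gM≈1 Mh≈1 = beginₘ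
    g                ≈⟨ ⊗-identity g ⟨
    g ⊗ identity     ≈⟨ ⊗-cong (≈ₘ-refl {g}) Mh≈1 ⟨
    g ⊗ (M ⊗ h)      ≈⟨ ⊗-assoc g M h ⟨
    (g ⊗ M) ⊗ h      ≈⟨ ⊗-cong gM≈1 (≈ₘ-refl {h}) ⟩
    identity ⊗ h     ≈⟨ identity-⊗ h ⟩
    h                ∎ₘ

  congruence-inverse : ∀ Z M d → (Z ⊗ M) ≈ₘ identity → (M ⊗ Z) ≈ₘ identity →
    (∀ i → d i * d i ≡ 1ℚ) → ((Z ᵀ ⊗ (d ⊙ Z)) ⊗ (M ⊗ (d ⊙ M ᵀ))) ≈ₘ identity
  congruence-inverse Z M d ZM≈1 MZ≈1 d²≡1 = beginₘ
    (Z ᵀ ⊗ (d ⊙ Z)) ⊗ (M ⊗ (d ⊙ M ᵀ))   ≈⟨ ⊗-assoc (Z ᵀ) (d ⊙ Z) _ ⟩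
    Z ᵀ ⊗ ((d ⊙ Z) ⊗ (M ⊗ (d ⊙ M ᵀ)))   ≈⟨ Zᵀ⊗ (⊗-assoc (d ⊙ Z) M _) ⟨
    Z ᵀ ⊗ (((d ⊙ Z) ⊗ M) ⊗ (d ⊙ M ᵀ))   ≈⟨ Zᵀ⊗ (⊗-cong (⊙-⊗ d Z M) (≈ₘ-refl {d ⊙ M ᵀ})) ⟩
    Z ᵀ ⊗ ((d ⊙ (Z ⊗ M)) ⊗ (d ⊙ M ᵀ))   ≈⟨ Zᵀ⊗ (⊙-⊗ d (Z ⊗ M) _) ⟩
    Z ᵀ ⊗ (d ⊙ ((Z ⊗ M) ⊗ (d ⊙ M ᵀ)))   ≈⟨ Zᵀ⊗ (⊙-cong d (⊗-cong ZM≈1 (≈ₘ-refl {d ⊙ M ᵀ}))) ⟩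
    Z ᵀ ⊗ (d ⊙ (identity ⊗ (d ⊙ M ᵀ)))  ≈⟨ Zᵀ⊗ (⊙-cong d (identity-⊗ (d ⊙ M ᵀ))) ⟩
    Z ᵀ ⊗ (d ⊙ d ⊙ M ᵀ)                 ≈⟨ Zᵀ⊗ (⊙-involutive d d²≡1 (M ᵀ)) ⟩
    Z ᵀ ⊗ M ᵀ                           ≈⟨ ᵀ-⊗ M Z ⟨
    (M ⊗ Z) ᵀ                           ≈⟨ (λ i j → MZ≈1 j i) ⟩
    identity ᵀ                          ≈⟨ identityᵀ ⟩
    identity                            ∎ₘ
    where
    Zᵀ⊗ : ∀ {P Q} → P ≈ₘ Q → (Z ᵀ ⊗ P) ≈ₘ (Z ᵀ ⊗ Q)
    Zᵀ⊗ = ⊗-cong (≈ₘ-refl {Z ᵀ})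

-- Toggling a vertex

sgn : ∀ {n} → Subset n → ℚ
sgn p = signℚ ∣ p ∣

toggle : ∀ {n} → Fin n → Subset n → Subset n
toggle zero    (b ∷ p) = not b ∷ p
toggle (suc v) (b ∷ p) = b ∷ toggle v p

toggle-involutive : ∀ {n} (v : Fin n) p → toggle v (toggle v p) ≡ p
toggle-involutive zero    (true  ∷ p) = refl
toggle-involutive zero    (false ∷ p) = refl
toggle-involutive (suc v) (b ∷ p)     = cong (b ∷_) (toggle-involutive v p)

sgn-toggle : ∀ {n} (v : Fin n) p → sgn (toggle v p) ≡ - sgn p
sgn-toggle zero    (true  ∷ p) = sym (-‿involutive (sgn p))
sgn-toggle zero    (false ∷ p) = refl
sgn-toggle (suc v) (true  ∷ p) = cong -_ (sgn-toggle v p)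
sgn-toggle (suc v) (false ∷ p) = sgn-toggle v p

toggle-⊥ : ∀ {n} (v : Fin n) → toggle v ⊥ ≡ ⁅ v ⁆
toggle-⊥ zero    = refl
toggle-⊥ (suc v) = cong (false ∷_) (toggle-⊥ v)

∈-toggle : ∀ {n} (v : Fin n) {u p} → ¬ u ≡ v → u ∈ p → u ∈ toggle v p
∈-toggle zero    {zero}  u≢v _         = ⊥-elim (u≢v refl)
∈-toggle zero    {suc u} u≢v (there u∈p) = there u∈p
∈-toggle (suc v) {zero}  u≢v here        = here
∈-toggle (suc v) {suc u} u≢v (there u∈p) = there (∈-toggle v (λ u≡v → u≢v (cong suc u≡v)) u∈p)

⊆-toggle : ∀ {n} (v : Fin n) {x p} → v ∉ x → x ⊆ p → x ⊆ toggle v p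
⊆-toggle v v∉x x⊆p {u} u∈x with u ≟ v
... | yes refl = ⊥-elim (v∉x u∈x)
... | no u≢v   = ∈-toggle v u≢v (x⊆p u∈x)

toggle-⊆ : ∀ {n} (v : Fin n) {p y} → v ∈ y → p ⊆ y → toggle v p ⊆ y
toggle-⊆ v {p} v∈y p⊆y {u} u∈t with u ≟ v
... | yes refl = v∈y
... | no u≢v   = p⊆y (subst (u ∈_) (toggle-involutive v p) (∈-toggle v u≢v u∈t))

⊆⇒≡⊎⊂ : ∀ {n} {p q : Subset n} → p ⊆ q → p ≡ q ⊎ p ⊂ q
⊆⇒≡⊎⊂ {p = p} {q} p⊆q with any? (λ u → (u ∈? q) ×-dec ¬? (u ∈? p))
... | yes witness = inj₂ (p⊆q , witness)
... | no  none    = inj₁ (⊆-antisym p⊆q q⊆p)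
  where
  q⊆p : q ⊆ p
  q⊆p {u} u∈q with u ∈? p
  ... | yes u∈p = u∈p
  ... | no  u∉p = ⊥-elim (none (u , u∈q , u∉p))

-- The face poset of a simplicial complex

module _ {n m} (G : SimplicialComplex n m) where

  private
    F : Fin m → Subset n
    F = face G

  ζ : Matrix m
  ζ i j = 𝟙 (F i ⊆? F j)

  ω : Fin m → ℚ
  ω i = - sgn (F i)

  μ : Matrix m
  μ i j = ζ i j * (ω i * ω j)

  ω-squared : ∀ i → ω i * ω i ≡ 1ℚ
  ω-squared i = trans (neg-*-neg (sgn (F i)) (sgn (F i))) (signℚ-squared ∣ F i ∣)

  signℚ-dim : ∀ i → signℚ (dim G i) ≡ ω i
  signℚ-dim i = signℚ-∣p∣∸1 (F i) (face-nonempty G i)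
    where
    signℚ-∣p∣∸1 : ∀ {k} (p : Subset k) → Nonempty p → signℚ (∣ p ∣ ∸ 1) ≡ - sgn p
    signℚ-∣p∣∸1 (true  ∷ p) _                   = sym (-‿involutive (sgn p))
    signℚ-∣p∣∸1 (false ∷ p) (suc u , there u∈p) = signℚ-∣p∣∸1 p (u , u∈p)

  ζ-idempotent : ∀ i j → ζ i j * ζ i j ≡ ζ i j
  ζ-idempotent i j = trans (𝟙-× i⊆?j i⊆?j) (𝟙-⇔ proj₁ (λ x → x , x) (i⊆?j ×-dec i⊆?j) i⊆?j)
    where
    i⊆?j : Dec (F i ⊆ F j)
    i⊆?j = F i ⊆? F j

  -- Pairing each face in Q with its toggle at v is a sign-reversing involution on Q.
  toggle-cancellation : ∀ {ℓ} (Q : Pred (Subset n) ℓ) (Q? : Decidable Q) (v : Fin n) (w : Fin m) →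
    (∀ {p} → Q p → Q (toggle v p)) → (∀ {p} → Q p → Nonempty p) → (∀ {p} → Q p → p ⊆ F w) →
    sumFin (λ z → 𝟙 (Q? (F z)) * ω z) ≡ 0ℚ
  toggle-cancellation Q Q? v w Q-toggle Q-nonempty Q-⊆ =
    sumFin-sign-reversing-involution σ σ-involutive _ term∘σ
    where
    partner : ∀ {z} → Q (F z) → ∃ λ j → F j ≡ toggle v (F z)
    partner q = face-closed G w _ (Q-nonempty (Q-toggle q)) (Q-⊆ (Q-toggle q))

    σ : Fin m → Fin m
    σ z with Q? (F z)
    ... | yes q = proj₁ (partner q)
    ... | no _  = z

    σ-yes : ∀ {z} → Q (F z) → F (σ z) ≡ toggle v (F z)
    σ-yes {z} q with Q? (F z)
    ... | yes q′ = proj₂ (partner q′)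
    ... | no ¬q  = ⊥-elim (¬q q)

    σ-no : ∀ {z} → ¬ Q (F z) → σ z ≡ z
    σ-no {z} ¬q with Q? (F z)
    ... | yes q = ⊥-elim (¬q q)
    ... | no _  = refl

    Q-σ : ∀ {z} → Q (F z) → Q (F (σ z))
    Q-σ q = subst Q (sym (σ-yes q)) (Q-toggle q)

    σ-involutive : ∀ z → σ (σ z) ≡ z
    σ-involutive z = by-cases (Q? (F z))
      where
      by-cases : Dec (Q (F z)) → σ (σ z) ≡ z
      by-cases (no ¬q) = trans (cong σ (σ-no ¬q)) (σ-no ¬q)
      by-cases (yes q) = face-injective G (begin
        F (σ (σ z))               ≡⟨ σ-yes (Q-σ q) ⟩
        toggle v (F (σ z))        ≡⟨ cong (toggle v) (σ-yes q) ⟩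
        toggle v (toggle v (F z)) ≡⟨ toggle-involutive v (F z) ⟩
        F z                       ∎)

    term∘σ : ∀ z → 𝟙 (Q? (F (σ z))) * ω (σ z) ≡ - (𝟙 (Q? (F z)) * ω z)
    term∘σ z = by-cases (Q? (F z))
      where
      by-cases : Dec (Q (F z)) → 𝟙 (Q? (F (σ z))) * ω (σ z) ≡ - (𝟙 (Q? (F z)) * ω z)
      by-cases (no ¬q) = begin
        𝟙 (Q? (F (σ z))) * ω (σ z) ≡⟨ cong (λ y → 𝟙 (Q? (F y)) * ω y) (σ-no ¬q) ⟩
        𝟙 (Q? (F z)) * ω z         ≡⟨ cong (_* ω z) (𝟙-no (Q? (F z)) ¬q) ⟩
        0ℚ * ω z                   ≡⟨ *-zeroˡ (ω z) ⟩
        - 0ℚ                       ≡⟨ cong -_ (*-zeroˡ (ω z)) ⟨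
        - (0ℚ * ω z)               ≡⟨ cong (λ y → - (y * ω z)) (𝟙-no (Q? (F z)) ¬q) ⟨
        - (𝟙 (Q? (F z)) * ω z)     ∎
      by-cases (yes q) = begin
        𝟙 (Q? (F (σ z))) * ω (σ z) ≡⟨ cong (_* ω (σ z)) (𝟙-yes (Q? (F (σ z))) (Q-σ q)) ⟩
        1ℚ * ω (σ z)               ≡⟨ *-identityˡ (ω (σ z)) ⟩
        - sgn (F (σ z))            ≡⟨ cong (λ p → - sgn p) (σ-yes q) ⟩
        - sgn (toggle v (F z))     ≡⟨ cong -_ (sgn-toggle v (F z)) ⟩
        - ω z                      ≡⟨ cong -_ (*-identityˡ (ω z)) ⟨
        - (1ℚ * ω z)               ≡⟨ cong (λ y → - (y * ω z)) (𝟙-yes (Q? (F z)) q) ⟨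
        - (𝟙 (Q? (F z)) * ω z)     ∎

  ζ-meet : ∀ {i j w} → F w ≡ F i ∩ F j → ∀ k → ζ k i * ζ k j ≡ ζ k w
  ζ-meet {i} {j} {w} F-w k =
    trans (𝟙-× (F k ⊆? F i) (F k ⊆? F j))
          (𝟙-⇔ to from ((F k ⊆? F i) ×-dec (F k ⊆? F j)) (F k ⊆? F w))
    where
    to : F k ⊆ F i × F k ⊆ F j → F k ⊆ F w
    to (k⊆i , k⊆j) u∈k = subst (_ ∈_) (sym F-w) (x∈p∩q⁺ (k⊆i u∈k , k⊆j u∈k))
    from : F k ⊆ F w → F k ⊆ F i × F k ⊆ F j
    from k⊆w = (λ u∈k → proj₁ (x∈p∩q⁻ (F i) (F j) (subst (_ ∈_) F-w (k⊆w u∈k))))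
             , (λ u∈k → proj₂ (x∈p∩q⁻ (F i) (F j) (subst (_ ∈_) F-w (k⊆w u∈k))))

  Pairable : Fin n → Fin m → Pred (Subset n) 0ℓ
  Pairable v w p = p ⊆ F w × Nonempty p × Nonempty (toggle v p)

  pairable? : ∀ v w → Decidable (Pairable v w)
  pairable? v w p = (p ⊆? F w) ×-dec nonempty? p ×-dec nonempty? (toggle v p)

  vertex-face : ∀ {v w} → v ∈ F w → ∃ λ x → F x ≡ ⁅ v ⁆
  vertex-face {v} {w} v∈w = face-closed G w ⁅ v ⁆ (v , x∈⁅x⁆ v) ⁅v⁆⊆w
    where
    ⁅v⁆⊆w : ⁅ v ⁆ ⊆ F w
    ⁅v⁆⊆w u∈⁅v⁆ = subst (_∈ F w) (sym (x∈⁅y⁆⇒x≡y v u∈⁅v⁆)) v∈w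

  -- The faces below w are the pairable ones together with the vertex ⁅ v ⁆, whose toggle is empty.
  ζ-split : ∀ {v w x} → v ∈ F w → F x ≡ ⁅ v ⁆ →
            ∀ k → ζ k w ≡ 𝟙 (pairable? v w (F k)) + identity x k
  ζ-split {v} {w} {x} v∈w F-x k = by-cases (F k ⊆? F w) (nonempty? (toggle v (F k)))
    where
    toggle-x : toggle v (F x) ≡ ⊥
    toggle-x = begin
      toggle v (F x)        ≡⟨ cong (toggle v) (trans F-x (sym (toggle-⊥ v))) ⟩
      toggle v (toggle v ⊥) ≡⟨ toggle-involutive v ⊥ ⟩
      ⊥                     ∎

    by-cases : Dec (F k ⊆ F w) → Dec (Nonempty (toggle v (F k))) →
               ζ k w ≡ 𝟙 (pairable? v w (F k)) + identity x k
    by-cases (no k⊈w) _ =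
      trans (𝟙-no (F k ⊆? F w) k⊈w)
            (sym (cong₂ _+_ (𝟙-no (pairable? v w (F k)) (λ (k⊆w , _) → k⊈w k⊆w)) (identity-≢ x≢k)))
      where
      x≢k : ¬ x ≡ k
      x≢k refl = k⊈w (λ u∈x → subst (_∈ F w) (sym (x∈⁅y⁆⇒x≡y v (subst (_ ∈_) F-x u∈x))) v∈w)
    by-cases (yes k⊆w) (yes t≠∅) =
      trans (𝟙-yes (F k ⊆? F w) k⊆w)
            (sym (cong₂ _+_ (𝟙-yes (pairable? v w (F k)) (k⊆w , face-nonempty G k , t≠∅))
                            (identity-≢ x≢k)))
      where
      x≢k : ¬ x ≡ k
      x≢k refl = ∉⊥ (subst (proj₁ t≠∅ ∈_) toggle-x (proj₂ t≠∅))
    by-cases (yes k⊆w) (no t≡∅) =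
      trans (𝟙-yes (F k ⊆? F w) k⊆w)
            (sym (cong₂ _+_ (𝟙-no (pairable? v w (F k)) (λ (_ , _ , t≠∅) → t≡∅ t≠∅))
                            (trans (cong (identity x) k≡x) (identity-refl x))))
      where
      k≡x : k ≡ x
      k≡x = face-injective G (begin
        F k                       ≡⟨ toggle-involutive v (F k) ⟨
        toggle v (toggle v (F k)) ≡⟨ cong (toggle v) (Empty-unique t≡∅) ⟩
        toggle v ⊥                ≡⟨ toggle-⊥ v ⟩
        ⁅ v ⁆                     ≡⟨ F-x ⟨
        F x                       ∎)

  simplex-euler-characteristic : ∀ w → sumFin (λ k → ζ k w * ω k) ≡ 1ℚ
  simplex-euler-characteristic w with face-nonempty G w
  ... | v , v∈w with vertex-face v∈w
  ...   | x , F-x = begin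
    sumFin (λ k → ζ k w * ω k)
      ≡⟨ sumFin-cong (λ k → trans (cong (_* ω k) (ζ-split v∈w F-x k))
                                  (*-distribʳ-+ (ω k) (𝟙 (pairable? v w (F k))) (identity x k))) ⟩
    sumFin (λ k → 𝟙 (pairable? v w (F k)) * ω k + identity x k * ω k)
      ≡⟨ sumFin-+ (λ k → 𝟙 (pairable? v w (F k)) * ω k) (λ k → identity x k * ω k) ⟩
    sumFin (λ k → 𝟙 (pairable? v w (F k)) * ω k) + sumFin (λ k → identity x k * ω k)
      ≡⟨ cong₂ _+_ pairable-cancel (sumFin-identityˡ x ω) ⟩
    0ℚ + ω x                 ≡⟨ +-identityˡ (ω x) ⟩
    - sgn (F x)              ≡⟨ cong (λ p → - sgn p) F-x ⟩
    - signℚ ∣ ⁅ v ⁆ ∣        ≡⟨ cong (λ k → - signℚ k) (∣⁅x⁆∣≡1 v) ⟩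
    1ℚ                       ∎
    where
    pairable-cancel : sumFin (λ k → 𝟙 (pairable? v w (F k)) * ω k) ≡ 0ℚ
    pairable-cancel = toggle-cancellation (Pairable v w) (pairable? v w) v w
      (λ {p} (p⊆w , p≠∅ , t≠∅) →
         toggle-⊆ v v∈w p⊆w , t≠∅ , subst Nonempty (sym (toggle-involutive v p)) p≠∅)
      (λ (_ , p≠∅ , _) → p≠∅)
      (λ (p⊆w , _) → p⊆w)

  Between : Fin m → Fin m → Pred (Subset n) 0ℓ
  Between i j p = F i ⊆ p × p ⊆ F j

  between? : ∀ i j → Decidable (Between i j)
  between? i j p = (F i ⊆? p) ×-dec (p ⊆? F j)

  between-self : ∀ i k → 𝟙 (between? i i (F k)) ≡ identity i k
  between-self i k = trans (𝟙-⇔ (λ (i⊆k , k⊆i) → face-injective G (⊆-antisym i⊆k k⊆i))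
                                (λ { refl → (λ u∈i → u∈i) , (λ u∈i → u∈i) })
                                (between? i i (F k)) (i ≟ k))
                           (sym (identity≡𝟙 i k))

  -- For F i ⊂ F j, toggling a vertex of j outside i pairs off the faces between i and j.
  signed-count-between-≢ : ∀ {i j} → ¬ i ≡ j → sumFin (λ k → 𝟙 (between? i j (F k)) * ω k) ≡ 0ℚ
  signed-count-between-≢ {i} {j} i≢j with F i ⊆? F j
  ... | no i⊈j =
    sumFin-𝟙-none (λ k → between? i j (F k)) ω (λ k (i⊆k , k⊆j) → i⊈j (⊆-trans i⊆k k⊆j))
  ... | yes i⊆j with ⊆⇒≡⊎⊂ i⊆j
  ...   | inj₁ F-i≡F-j = ⊥-elim (i≢j (face-injective G F-i≡F-j))
  ...   | inj₂ (_ , v , v∈j , v∉i) =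
    toggle-cancellation (Between i j) (between? i j) v j
      (λ (i⊆p , p⊆j) → ⊆-toggle v v∉i i⊆p , toggle-⊆ v v∈j p⊆j)
      (λ (i⊆p , _) → proj₁ (face-nonempty G i) , i⊆p (proj₂ (face-nonempty G i)))
      (λ (_ , p⊆j) → p⊆j)

  signed-interval-sum : ∀ i j → sumFin (λ k → ζ i k * ζ k j * ω k) ≡ identity i j * ω i
  signed-interval-sum i j = begin
    sumFin (λ k → ζ i k * ζ k j * ω k)
      ≡⟨ sumFin-cong (λ k → cong (_* ω k) (𝟙-× (F i ⊆? F k) (F k ⊆? F j))) ⟩
    sumFin (λ k → 𝟙 (between? i j (F k)) * ω k)
      ≡⟨ by-cases (i ≟ j) ⟩
    identity i j * ω i ∎
    where
    by-cases : Dec (i ≡ j) → sumFin (λ k → 𝟙 (between? i j (F k)) * ω k) ≡ identity i j * ω i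
    by-cases (yes refl) = begin
      sumFin (λ k → 𝟙 (between? i i (F k)) * ω k)
        ≡⟨ sumFin-cong (λ k → cong (_* ω k) (between-self i k)) ⟩
      sumFin (λ k → identity i k * ω k)           ≡⟨ sumFin-identityˡ i ω ⟩
      ω i                                         ≡⟨ *-identityˡ (ω i) ⟨
      1ℚ * ω i                                    ≡⟨ cong (_* ω i) (identity-refl i) ⟨
      identity i i * ω i                          ∎
    by-cases (no i≢j) = begin
      sumFin (λ k → 𝟙 (between? i j (F k)) * ω k) ≡⟨ signed-count-between-≢ i≢j ⟩
      0ℚ                                          ≡⟨ *-zeroˡ (ω i) ⟨
      0ℚ * ω i                                    ≡⟨ cong (_* ω i) (identity-≢ i≢j) ⟨
      identity i j * ω i                          ∎

  onePlusA≡𝟙-meet : ∀ i j → onePlusA G i j ≡ 𝟙 (nonempty? (F i ∩ F j))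
  onePlusA≡𝟙-meet i j with i ≟ j
  ... | yes refl with face-nonempty G i
  ...   | u , u∈i = sym (𝟙-yes (nonempty? (F i ∩ F i)) (u , x∈p∩q⁺ (u∈i , u∈i)))
  onePlusA≡𝟙-meet i j | no _ with nonempty? (F i ∩ F j)
  ...   | yes _ = refl
  ...   | no _  = refl

  -- Faces below both i and j are exactly the faces below the face F i ∩ F j, when that is non-empty.
  onePlusA-factorisation : onePlusA G ≈ₘ (ζ ᵀ ⊗ (ω ⊙ ζ))
  onePlusA-factorisation i j = trans (onePlusA≡𝟙-meet i j) (by-cases (nonempty? (F i ∩ F j)))
    where
    regroup : ∀ a b c → a * (b * c) ≡ a * c * b
    regroup = solve-∀ ℚ-ring

    by-cases : (d : Dec (Nonempty (F i ∩ F j))) → 𝟙 d ≡ sumFin (λ k → ζ k i * (ω k * ζ k j))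
    by-cases (yes i∩j≠∅) with face-closed G i (F i ∩ F j) i∩j≠∅ (p∩q⊆p (F i) (F j))
    ... | w , F-w = sym (begin
      sumFin (λ k → ζ k i * (ω k * ζ k j))
        ≡⟨ sumFin-cong (λ k → trans (regroup (ζ k i) (ω k) (ζ k j)) (cong (_* ω k) (ζ-meet F-w k))) ⟩
      sumFin (λ k → ζ k w * ω k)
        ≡⟨ simplex-euler-characteristic w ⟩
      1ℚ ∎)
    by-cases (no i∩j≡∅) = sym (begin
      sumFin (λ k → ζ k i * (ω k * ζ k j))
        ≡⟨ sumFin-cong (λ k → trans (regroup (ζ k i) (ω k) (ζ k j))
                                   (cong (_* ω k) (𝟙-× (F k ⊆? F i) (F k ⊆? F j)))) ⟩
      sumFin (λ k → 𝟙 ((F k ⊆? F i) ×-dec (F k ⊆? F j)) * ω k)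
        ≡⟨ sumFin-𝟙-none (λ k → (F k ⊆? F i) ×-dec (F k ⊆? F j)) ω below-both-empty ⟩
      0ℚ ∎)
      where
      below-both-empty : ∀ k → ¬ (F k ⊆ F i × F k ⊆ F j)
      below-both-empty k (k⊆i , k⊆j) with face-nonempty G k
      ... | u , u∈k = i∩j≡∅ (u , x∈p∩q⁺ (k⊆i u∈k , k⊆j u∈k))

  ζ⊗μ : (ζ ⊗ μ) ≈ₘ identity
  ζ⊗μ i j = begin
    sumFin (λ k → ζ i k * (ζ k j * (ω k * ω j)))
      ≡⟨ sumFin-cong (λ k → regroup (ζ i k) (ζ k j) (ω k) (ω j)) ⟩
    sumFin (λ k → ζ i k * ζ k j * ω k * ω j)
      ≡⟨ sumFin-*ʳ (ω j) (λ k → ζ i k * ζ k j * ω k) ⟩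
    sumFin (λ k → ζ i k * ζ k j * ω k) * ω j
      ≡⟨ cong (_* ω j) (signed-interval-sum i j) ⟩
    identity i j * ω i * ω j
      ≡⟨ cong (_* ω j) (*-comm (identity i j) (ω i)) ⟩
    ω i * identity i j * ω j
      ≡⟨ identity-conj ω ω-squared i j ⟩
    identity i j ∎
    where
    regroup : ∀ a b c d → a * (b * (c * d)) ≡ a * b * c * d
    regroup = solve-∀ ℚ-ring

  μ⊗ζ : (μ ⊗ ζ) ≈ₘ identity
  μ⊗ζ i j = begin
    sumFin (λ k → ζ i k * (ω i * ω k) * ζ k j)
      ≡⟨ sumFin-cong (λ k → regroup (ζ i k) (ω i) (ω k) (ζ k j)) ⟩
    sumFin (λ k → ω i * (ζ i k * ζ k j * ω k))
      ≡⟨ sumFin-*ˡ (ω i) (λ k → ζ i k * ζ k j * ω k) ⟩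
    ω i * sumFin (λ k → ζ i k * ζ k j * ω k)
      ≡⟨ cong (ω i *_) (signed-interval-sum i j) ⟩
    ω i * (identity i j * ω i)
      ≡⟨ cong (ω i *_) (identity-*-reindex ω i j) ⟩
    ω i * (identity i j * ω j)
      ≡⟨ *-assoc (ω i) (identity i j) (ω j) ⟨
    ω i * identity i j * ω j
      ≡⟨ identity-conj ω ω-squared i j ⟩
    identity i j ∎
    where
    regroup : ∀ a b c d → a * (b * c) * d ≡ b * (a * d * c)
    regroup = solve-∀ ℚ-ring

  μ-column-sum : ∀ k → sumFin (λ y → μ y k) ≡ ω k
  μ-column-sum k = begin
    sumFin (λ y → ζ y k * (ω y * ω k)) ≡⟨ sumFin-cong (λ y → *-assoc (ζ y k) (ω y) (ω k)) ⟨
    sumFin (λ y → ζ y k * ω y * ω k)   ≡⟨ sumFin-*ʳ (ω k) (λ y → ζ y k * ω y) ⟩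
    sumFin (λ y → ζ y k * ω y) * ω k   ≡⟨ cong (_* ω k) (simplex-euler-characteristic k) ⟩
    1ℚ * ω k                           ≡⟨ *-identityˡ (ω k) ⟩
    ω k                                ∎

  green : Matrix m
  green = μ ⊗ (ω ⊙ μ ᵀ)

  green-right-inverse : (onePlusA G ⊗ green) ≈ₘ identity
  green-right-inverse = ≈ₘ-trans (⊗-cong onePlusA-factorisation (≈ₘ-refl {x = green}))
                                 (congruence-inverse ζ μ ω ζ⊗μ μ⊗ζ ω-squared)

  green-row-sum : ∀ x → sumFin (λ y → green x y) ≡ sumFin (λ k → μ x k)
  green-row-sum x = begin
    sumFin (λ y → sumFin (λ k → μ x k * (ω k * μ y k)))
      ≡⟨ sumFin-comm (λ y k → μ x k * (ω k * μ y k)) ⟩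
    sumFin (λ k → sumFin (λ y → μ x k * (ω k * μ y k)))
      ≡⟨ sumFin-cong (λ k → sumFin-*ˡ (μ x k) (λ y → ω k * μ y k)) ⟩
    sumFin (λ k → μ x k * sumFin (λ y → ω k * μ y k))
      ≡⟨ sumFin-cong (λ k → cong (μ x k *_) (sumFin-*ˡ (ω k) (λ y → μ y k))) ⟩
    sumFin (λ k → μ x k * (ω k * sumFin (λ y → μ y k)))
      ≡⟨ sumFin-cong (λ k → cong (λ s → μ x k * (ω k * s)) (μ-column-sum k)) ⟩
    sumFin (λ k → μ x k * (ω k * ω k))
      ≡⟨ sumFin-cong (λ k → trans (cong (μ x k *_) (ω-squared k)) (*-identityʳ (μ x k))) ⟩
    sumFin (λ k → μ x k) ∎

  green-diagonal : ∀ x → ω x * green x x ≡ sumFin (λ k → μ x k)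
  green-diagonal x = begin
    ω x * sumFin (λ k → μ x k * (ω k * μ x k))
      ≡⟨ sumFin-*ˡ (ω x) (λ k → μ x k * (ω k * μ x k)) ⟨
    sumFin (λ k → ω x * (μ x k * (ω k * μ x k)))
      ≡⟨ sumFin-cong term ⟩
    sumFin (λ k → μ x k) ∎
    where
    expand : ∀ z s t → s * (z * (s * t) * (t * (z * (s * t)))) ≡ z * z * (s * s) * (t * t) * (s * t)
    expand = solve-∀ ℚ-ring

    term : ∀ k → ω x * (μ x k * (ω k * μ x k)) ≡ μ x k
    term k = begin
      ω x * (μ x k * (ω k * μ x k))
        ≡⟨ expand (ζ x k) (ω x) (ω k) ⟩
      ζ x k * ζ x k * (ω x * ω x) * (ω k * ω k) * (ω x * ω k)
        ≡⟨ cong (λ z → z * (ω x * ω x) * (ω k * ω k) * (ω x * ω k)) (ζ-idempotent x k) ⟩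
      ζ x k * (ω x * ω x) * (ω k * ω k) * (ω x * ω k)
        ≡⟨ cong₂ (λ a b → ζ x k * a * b * (ω x * ω k)) (ω-squared x) (ω-squared k) ⟩
      ζ x k * 1ℚ * 1ℚ * (ω x * ω k)
        ≡⟨ cong (_* (ω x * ω k)) (trans (*-identityʳ (ζ x k * 1ℚ)) (*-identityʳ (ζ x k))) ⟩
      μ x k ∎

proposition1 : ∀ {n m} (G : SimplicialComplex n m) (g : Matrix m) →
    IsInverse (onePlusA G) g →
    ∀ (x : Fin m) → sumFin (λ y → g x y) ≡ signℚ (dim G x) * g x x
proposition1 G g (_ , g-left-inverse) x = begin
  sumFin (λ y → g x y)           ≡⟨ sumFin-cong (g≈green x) ⟩
  sumFin (λ y → green G x y)     ≡⟨ green-row-sum G x ⟩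
  sumFin (λ k → μ G x k)         ≡⟨ green-diagonal G x ⟨
  ω G x * green G x x            ≡⟨ cong₂ _*_ (signℚ-dim G x) (g≈green x x) ⟨
  signℚ (dim G x) * g x x        ∎
  where
  g≈green : g ≈ₘ green G
  g≈green = left-inverse≈right-inverse g-left-inverse (green-right-inverse G)
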